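{- Let $n\ge 2$, let $T_1,\dots,T_n$ be positive integers with $T_i/T_{i+1}$ an integer for all $i<n$, let $C_1,\dots,C_{n-1}\ge 0$ and $J_1,\dots,J_n$ be numbers, let $c_i=\sum_{t=i+1}^{n-1}C_t$ for $i=1,\dots,n$ (empty sums are $0$), and assume $\sum_{t=1}^{n-1} C_t/T_t < 1$. Consider the system in integer variables $x_1,\dots,x_n$: \[J_i + T_ix_i \leq J_n + T_nx_n \leq J_i+T_ix_i + c_i \qquad \forall i\leq n-1.\] If $i<n$ and $k=\max\{t\le n : T_t=T_{i+1}\}$, then for every integer $z$ there is at most one integer $y$ such that the system has an integer solution $(x_1,\dots,x_n)$ with $x_i=z$ and $x_k=y$.
   Context: This system arises from worst-case response time analysis of harmonic tasks with release jitter on a uniprocessor: $T_i$ are periods, $C_i$ processing times, $J_i$ release jitters.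
   Formalization: The numbers $C_1,\dots,C_{n-1}$ and $J_1,\dots,J_n$ (processing times and release jitters) are rational. -}

module Defs where

open import Data.Nat as ℕ using (ℕ; zero; suc)
open import Data.Integer as ℤ using (ℤ; +_)
open import Data.Rational as ℚ using (ℚ; 0ℚ; 1ℚ)

ℤ→ℚ : ℤ → ℚ
ℤ→ℚ z = z ℚ./ 1

ℕ→ℚ : ℕ → ℚ
ℕ→ℚ m = ℤ→ℚ (+ m)

-- q / m for a natural m; the value for m = 0 is an irrelevant convention
-- (only used where m = T t > 0 by hypothesis)
divℕ : ℚ → ℕ → ℚ
divℕ q zero    = 0ℚ
divℕ q (suc m) = q ℚ.* (+ 1 ℚ./ suc m)

sumFrom : (ℕ → ℚ) → ℕ → ℕ → ℚ
sumFrom f a zero    = 0ℚ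
sumFrom f a (suc m) = f a ℚ.+ sumFrom f (suc a) m

-- Σ_{t=a}^{b} f t  (empty, i.e. 0, when b < a)
sumRange : (ℕ → ℚ) → ℕ → ℕ → ℚ
sumRange f a b = sumFrom f a (suc b ℕ.∸ a)

cc : ℕ → (ℕ → ℚ) → ℕ → ℚ
cc n C i = sumRange C (suc i) (n ℕ.∸ 1)

pt : (T : ℕ → ℕ) (J : ℕ → ℚ) (x : ℕ → ℤ) → ℕ → ℚ
pt T J x i = J i ℚ.+ ℤ→ℚ (+ T i ℤ.* x i)

IsSolution : (n : ℕ) (T : ℕ → ℕ) (C J : ℕ → ℚ) (x : ℕ → ℤ) → Set
IsSolution n T C J x =
  ∀ i → 1 ℕ.≤ i → i ℕ.< n →
    (pt T J x i ℚ.≤ pt T J x n) × (pt T J x n ℚ.≤ pt T J x i ℚ.+ cc n C i)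
  where open import Data.Product using (_×_)

IsMaxEqPeriod : (n : ℕ) (T : ℕ → ℕ) (i k : ℕ) → Set
IsMaxEqPeriod n T i k =
  (1 ℕ.≤ k) × (k ℕ.≤ n) × (T k ≡ T (suc i)) ×
  (∀ t → 1 ℕ.≤ t → t ℕ.≤ n → T t ≡ T (suc i) → t ℕ.≤ k)
  where open import Data.Product using (_×_)
        open import Relation.Binary.PropositionalEquality using (_≡_)

{-# OPTIONS --safe #-}
-- Fixing x_i confines J_n + T_n x_n to the window [J_i + T_i x_i, J_i + T_i x_i + c_i], and row k
-- of the system then confines J_k + T_k x_k to a window of length c_i + c_k. Periods are
-- non-increasing, so T_t ≤ T_{i+1} = T_k for i < t ≤ k, while for t > k even 2 T_t ≤ T_k, since
-- by maximality of k the period T_{k+1} is a proper divisor of T_k. Hence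
-- c_i + c_k ≤ T_k Σ_{t>i} C_t / T_t < T_k, and the window meets J_k + T_k ℤ at most once.
module Submission where

open import Defs
open import Data.Nat as ℕ using (ℕ; suc; zero; z≤n; s≤s)
import Data.Nat.Properties as ℕP
open import Data.Nat.Divisibility using (_∣_; divides; ∣⇒≤)
open import Data.Integer as ℤ using (ℤ; +_)
import Data.Integer.Properties as ℤP
open import Data.Rational as ℚ using (ℚ; 0ℚ; 1ℚ; mkℚ)
import Data.Rational.Properties as ℚP
open import Data.Rational.Literals using (fromℤ)
open import Data.Nat.Coprimality using (1-coprimeTo)
open import Data.Product using (_×_; _,_; proj₁; proj₂)
open import Data.Sum using (inj₁; inj₂)
open import Data.Empty using (⊥-elim)
open import Relation.Nullary using (yes; no)
open import Relation.Binary.PropositionalEquality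

ℤ→ℚ≡fromℤ : ∀ z → ℤ→ℚ z ≡ fromℤ z
ℤ→ℚ≡fromℤ z = ℚP.↥p/↧p≡p (fromℤ z)

ℤ→ℚ-+ : ∀ a b → ℤ→ℚ (a ℤ.+ b) ≡ ℤ→ℚ a ℚ.+ ℤ→ℚ b
ℤ→ℚ-+ a b rewrite ℤ→ℚ≡fromℤ a | ℤ→ℚ≡fromℤ b =
  ℚP./-cong (sym (cong₂ ℤ._+_ (ℤP.*-identityʳ a) (ℤP.*-identityʳ b))) refl

ℤ→ℚ-mono-≤ : ∀ {a b} → a ℤ.≤ b → ℤ→ℚ a ℚ.≤ ℤ→ℚ b
ℤ→ℚ-mono-≤ {a} {b} a≤b rewrite ℤ→ℚ≡fromℤ a | ℤ→ℚ≡fromℤ b =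
  ℚ.*≤* (subst₂ ℤ._≤_ (sym (ℤP.*-identityʳ a)) (sym (ℤP.*-identityʳ b)) a≤b)

ℤ→ℚ-mono-< : ∀ {a b} → a ℤ.< b → ℤ→ℚ a ℚ.< ℤ→ℚ b
ℤ→ℚ-mono-< {a} {b} a<b rewrite ℤ→ℚ≡fromℤ a | ℤ→ℚ≡fromℤ b =
  ℚ.*<* (subst₂ ℤ._<_ (sym (ℤP.*-identityʳ a)) (sym (ℤP.*-identityʳ b)) a<b)

ℤ→ℚ-cancel-< : ∀ {a b} → ℤ→ℚ a ℚ.< ℤ→ℚ b → a ℤ.< b
ℤ→ℚ-cancel-< {a} {b} a<b rewrite ℤ→ℚ≡fromℤ a | ℤ→ℚ≡fromℤ b with a<b
... | ℚ.*<* a<b′ = subst₂ ℤ._<_ (ℤP.*-identityʳ a) (ℤP.*-identityʳ b) a<b′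

ℕ→ℚ-mono-≤ : ∀ {a b} → a ℕ.≤ b → ℕ→ℚ a ℚ.≤ ℕ→ℚ b
ℕ→ℚ-mono-≤ a≤b = ℤ→ℚ-mono-≤ (ℤ.+≤+ a≤b)

ℕ→ℚ-mono-< : ∀ {a b} → a ℕ.< b → ℕ→ℚ a ℚ.< ℕ→ℚ b
ℕ→ℚ-mono-< a<b = ℤ→ℚ-mono-< (ℤ.+<+ a<b)

+-cancelˡ-< : ∀ r {p q} → r ℚ.+ p ℚ.< r ℚ.+ q → p ℚ.< q
+-cancelˡ-< r {p} {q} r+p<r+q = subst₂ ℚ._<_ (-r+[r+s]≡s p) (-r+[r+s]≡s q) (ℚP.+-monoʳ-< (ℚ.- r) r+p<r+q)
  where
  open ≡-Reasoning
  -r+[r+s]≡s : ∀ s → ℚ.- r ℚ.+ (r ℚ.+ s) ≡ s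
  -r+[r+s]≡s s = begin
    ℚ.- r ℚ.+ (r ℚ.+ s) ≡⟨ sym (ℚP.+-assoc (ℚ.- r) r s) ⟩
    (ℚ.- r ℚ.+ r) ℚ.+ s ≡⟨ cong (ℚ._+ s) (ℚP.+-inverseˡ r) ⟩
    0ℚ ℚ.+ s            ≡⟨ ℚP.+-identityˡ s ⟩
    s                   ∎

ℕ→ℚ-*-divℕ : ∀ a q → ℕ→ℚ (suc a) ℚ.* divℕ q (suc a) ≡ q
ℕ→ℚ-*-divℕ a q = begin
  ℕ→ℚ (suc a) ℚ.* (q ℚ.* (+ 1 ℚ./ suc a)) ≡⟨ cong₂ (λ r s → r ℚ.* (q ℚ.* s)) (ℤ→ℚ≡fromℤ (+ suc a)) 1/1+a≡1/p ⟩
  p ℚ.* (q ℚ.* ℚ.1/ p)                     ≡⟨ cong (p ℚ.*_) (ℚP.*-comm q (ℚ.1/ p)) ⟩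
  p ℚ.* (ℚ.1/ p ℚ.* q)                     ≡⟨ sym (ℚP.*-assoc p (ℚ.1/ p) q) ⟩
  (p ℚ.* ℚ.1/ p) ℚ.* q                     ≡⟨ cong (ℚ._* q) (ℚP.*-inverseʳ p) ⟩
  1ℚ ℚ.* q                                 ≡⟨ ℚP.*-identityˡ q ⟩
  q                                        ∎
  where
  open ≡-Reasoning
  p = fromℤ (+ suc a)
  1/1+a≡1/p : + 1 ℚ./ suc a ≡ ℚ.1/ p
  1/1+a≡1/p = ℚP.↥p/↧p≡p (mkℚ (+ 1) a (1-coprimeTo (suc a)))

divℕ-nonNeg : ∀ q a → 0ℚ ℚ.≤ q → 0ℚ ℚ.≤ divℕ q a
divℕ-nonNeg q zero    _   = ℚP.≤-refl
divℕ-nonNeg q (suc a) 0≤q = ℚP.nonNegative⁻¹ _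
  {{ℚP.nonNeg*nonNeg⇒nonNeg q {{ℚ.nonNegative 0≤q}} (+ 1 ℚ./ suc a) {{ℚ.nonNegative 0≤1/1+a}}}}
  where
  0≤1/1+a : 0ℚ ℚ.≤ + 1 ℚ./ suc a
  0≤1/1+a = subst (0ℚ ℚ.≤_) (sym (ℚP.↥p/↧p≡p (mkℚ (+ 1) a (1-coprimeTo (suc a))))) (ℚ.*≤* (ℤ.+≤+ z≤n))

≤-*-divℕ : ∀ {a b} q → 0 ℕ.< a → a ℕ.≤ b → 0ℚ ℚ.≤ q → q ℚ.≤ ℕ→ℚ b ℚ.* divℕ q a
≤-*-divℕ {suc a} {b} q _ a≤b 0≤q = begin
  q                               ≡⟨ sym (ℕ→ℚ-*-divℕ a q) ⟩
  ℕ→ℚ (suc a) ℚ.* divℕ q (suc a) ≤⟨ ℚP.*-monoʳ-≤-nonNeg _ {{ℚ.nonNegative (divℕ-nonNeg q (suc a) 0≤q)}} (ℕ→ℚ-mono-≤ a≤b) ⟩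
  ℕ→ℚ b ℚ.* divℕ q (suc a)       ∎
  where open ℚP.≤-Reasoning

m∣n∧m≢n⇒m+m≤n : ∀ {m n} → 0 ℕ.< n → m ∣ n → m ≢ n → m ℕ.+ m ℕ.≤ n
m∣n∧m≢n⇒m+m≤n     0<n (divides zero          n≡0)   _   = ⊥-elim (ℕP.<⇒≢ 0<n (sym n≡0))
m∣n∧m≢n⇒m+m≤n     _   (divides (suc zero)    n≡m+0) m≢n = ⊥-elim (m≢n (sym (trans n≡m+0 (ℕP.+-identityʳ _))))
m∣n∧m≢n⇒m+m≤n {m} _   (divides (suc (suc q)) refl)  _   = ℕP.+-monoʳ-≤ m (ℕP.m≤m+n m (q ℕ.* m))

sumFrom-+ : ∀ f a L M → sumFrom f a (L ℕ.+ M) ≡ sumFrom f a L ℚ.+ sumFrom f (a ℕ.+ L) M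
sumFrom-+ f a zero    M rewrite ℕP.+-identityʳ a = sym (ℚP.+-identityˡ _)
sumFrom-+ f a (suc L) M rewrite sumFrom-+ f (suc a) L M | ℕP.+-suc a L = sym (ℚP.+-assoc (f a) _ _)

sumFrom-split : ∀ f {a b c} → a ℕ.≤ b → b ℕ.≤ c →
  sumFrom f a (c ℕ.∸ a) ≡ sumFrom f a (b ℕ.∸ a) ℚ.+ sumFrom f b (c ℕ.∸ b)
sumFrom-split f {a} {b} {c} a≤b b≤c = begin
  sumFrom f a (c ℕ.∸ a)                                            ≡⟨ cong (sumFrom f a) c∸a≡[b∸a]+[c∸b] ⟩
  sumFrom f a ((b ℕ.∸ a) ℕ.+ (c ℕ.∸ b))                            ≡⟨ sumFrom-+ f a (b ℕ.∸ a) (c ℕ.∸ b) ⟩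
  sumFrom f a (b ℕ.∸ a) ℚ.+ sumFrom f (a ℕ.+ (b ℕ.∸ a)) (c ℕ.∸ b) ≡⟨ cong (λ d → sumFrom f a (b ℕ.∸ a) ℚ.+ sumFrom f d (c ℕ.∸ b))
                                                                        (ℕP.m+[n∸m]≡n a≤b) ⟩
  sumFrom f a (b ℕ.∸ a) ℚ.+ sumFrom f b (c ℕ.∸ b)                  ∎
  where
  open ≡-Reasoning
  c∸a≡[b∸a]+[c∸b] : c ℕ.∸ a ≡ (b ℕ.∸ a) ℕ.+ (c ℕ.∸ b)
  c∸a≡[b∸a]+[c∸b] = begin
    c ℕ.∸ a                       ≡⟨ cong (ℕ._∸ a) (sym (ℕP.m∸n+n≡m b≤c)) ⟩
    (c ℕ.∸ b ℕ.+ b) ℕ.∸ a         ≡⟨ ℕP.+-∸-assoc (c ℕ.∸ b) a≤b ⟩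
    (c ℕ.∸ b) ℕ.+ (b ℕ.∸ a)       ≡⟨ ℕP.+-comm (c ℕ.∸ b) (b ℕ.∸ a) ⟩
    (b ℕ.∸ a) ℕ.+ (c ℕ.∸ b)       ∎

sumFrom-nonNeg : ∀ f a L → (∀ t → a ℕ.≤ t → t ℕ.< a ℕ.+ L → 0ℚ ℚ.≤ f t) → 0ℚ ℚ.≤ sumFrom f a L
sumFrom-nonNeg f a zero    _  = ℚP.≤-refl
sumFrom-nonNeg f a (suc L) f≥0 = ℚP.+-mono-≤ (f≥0 a ℕP.≤-refl (ℕP.m<m+n a (s≤s z≤n)))
  (sumFrom-nonNeg f (suc a) L λ t a<t t<end → f≥0 t (ℕP.<⇒≤ a<t) (subst (t ℕ.<_) (sym (ℕP.+-suc a L)) t<end))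

sumFrom-≤-* : ∀ f g B a L → (∀ t → a ℕ.≤ t → t ℕ.< a ℕ.+ L → f t ℚ.≤ B ℚ.* g t) →
  sumFrom f a L ℚ.≤ B ℚ.* sumFrom g a L
sumFrom-≤-* f g B a zero    _    = ℚP.≤-reflexive (sym (ℚP.*-zeroʳ B))
sumFrom-≤-* f g B a (suc L) f≤Bg = begin
  f a ℚ.+ sumFrom f (suc a) L             ≤⟨ ℚP.+-mono-≤ (f≤Bg a ℕP.≤-refl (ℕP.m<m+n a (s≤s z≤n)))
    (sumFrom-≤-* f g B (suc a) L λ t a<t t<end → f≤Bg t (ℕP.<⇒≤ a<t) (subst (t ℕ.<_) (sym (ℕP.+-suc a L)) t<end)) ⟩
  B ℚ.* g a ℚ.+ B ℚ.* sumFrom g (suc a) L ≡⟨ sym (ℚP.*-distribˡ-+ B (g a) _) ⟩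
  B ℚ.* (g a ℚ.+ sumFrom g (suc a) L)     ∎
  where open ℚP.≤-Reasoning

double-≤-* : ∀ {p g a b} → 0ℚ ℚ.≤ g → p ℚ.≤ ℕ→ℚ b ℚ.* g → b ℕ.+ b ℕ.≤ a → p ℚ.+ p ℚ.≤ ℕ→ℚ a ℚ.* g
double-≤-* {p} {g} {a} {b} 0≤g p≤bg b+b≤a = begin
  p ℚ.+ p                         ≤⟨ ℚP.+-mono-≤ p≤bg p≤bg ⟩
  ℕ→ℚ b ℚ.* g ℚ.+ ℕ→ℚ b ℚ.* g     ≡⟨ sym (ℚP.*-distribʳ-+ g (ℕ→ℚ b) (ℕ→ℚ b)) ⟩
  (ℕ→ℚ b ℚ.+ ℕ→ℚ b) ℚ.* g         ≡⟨ cong (ℚ._* g) (sym (ℤ→ℚ-+ (+ b) (+ b))) ⟩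
  ℕ→ℚ (b ℕ.+ b) ℚ.* g             ≤⟨ ℚP.*-monoʳ-≤-nonNeg g {{ℚ.nonNegative 0≤g}} (ℕ→ℚ-mono-≤ b+b≤a) ⟩
  ℕ→ℚ a ℚ.* g                     ∎
  where open ℚP.≤-Reasoning

offset-multiple-<⇒≤ : ∀ r t a b → r ℚ.+ ℤ→ℚ (+ t ℤ.* a) ℚ.< r ℚ.+ ℤ→ℚ (+ t ℤ.* b) ℚ.+ ℕ→ℚ t → a ℤ.≤ b
offset-multiple-<⇒≤ r t a b r+ta<r+tb+t = subst (a ℤ.≤_) (ℤP.pred-suc b)
  (ℤP.i<j⇒i≤pred[j] (ℤP.*-cancelˡ-<-nonNeg (+ t) (ℤ→ℚ-cancel-< (+-cancelˡ-< r (subst (_ ℚ.<_) r+tb+t≡r+t[1+b] r+ta<r+tb+t)))))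
  where
  open ≡-Reasoning
  r+tb+t≡r+t[1+b] : r ℚ.+ ℤ→ℚ (+ t ℤ.* b) ℚ.+ ℕ→ℚ t ≡ r ℚ.+ ℤ→ℚ (+ t ℤ.* ℤ.suc b)
  r+tb+t≡r+t[1+b] = begin
    r ℚ.+ ℤ→ℚ (+ t ℤ.* b) ℚ.+ ℕ→ℚ t       ≡⟨ ℚP.+-assoc r _ _ ⟩
    r ℚ.+ (ℤ→ℚ (+ t ℤ.* b) ℚ.+ ℕ→ℚ t)     ≡⟨ cong (r ℚ.+_) (sym (ℤ→ℚ-+ (+ t ℤ.* b) (+ t))) ⟩
    r ℚ.+ ℤ→ℚ (+ t ℤ.* b ℤ.+ + t)         ≡⟨ cong (λ z → r ℚ.+ ℤ→ℚ z) (ℤP.+-comm (+ t ℤ.* b) (+ t)) ⟩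
    r ℚ.+ ℤ→ℚ (+ t ℤ.+ + t ℤ.* b)         ≡⟨ cong (λ z → r ℚ.+ ℤ→ℚ z) (sym (ℤP.*-suc (+ t) b)) ⟩
    r ℚ.+ ℤ→ℚ (+ t ℤ.* ℤ.suc b)           ∎

module HarmonicTasks (m : ℕ) (T : ℕ → ℕ) (C : ℕ → ℚ)
  (T-pos      : ∀ t → 1 ℕ.≤ t → t ℕ.≤ suc m → 0 ℕ.< T t)
  (T-harmonic : ∀ t → 1 ℕ.≤ t → t ℕ.< suc m → T (suc t) ∣ T t)
  (C-nonNeg   : ∀ t → 1 ℕ.≤ t → t ℕ.< suc m → 0ℚ ℚ.≤ C t)
  where

  -- The system has n = suc m rows; U t is the utilisation C_t / T_t.
  U : ℕ → ℚ
  U t = divℕ (C t) (T t)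

  c : ℕ → ℚ
  c = cc (suc m) C

  m≤j⇒cⱼ≡0 : ∀ {j} → m ℕ.≤ j → c j ≡ 0ℚ
  m≤j⇒cⱼ≡0 m≤j = cong (sumFrom C (suc _)) (ℕP.m≤n⇒m∸n≡0 m≤j)

  T-antitone : ∀ {s t} → 1 ℕ.≤ s → s ℕ.≤ t → t ℕ.≤ suc m → T t ℕ.≤ T s
  T-antitone {s} 1≤s s≤t = go (ℕP.≤⇒≤′ s≤t)
    where
    go : ∀ {t} → s ℕ.≤′ t → t ℕ.≤ suc m → T t ℕ.≤ T s
    go ℕ.≤′-refl                 _     = ℕP.≤-refl
    go (ℕ.≤′-step {t} s≤′t) 1+t≤n = ℕP.≤-trans
      (∣⇒≤ {{ℕ.>-nonZero (T-pos t 1≤t t≤n)}} (T-harmonic t 1≤t 1+t≤n))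
      (go s≤′t t≤n)
      where
      1≤t = ℕP.≤-trans 1≤s (ℕP.≤′⇒≤ s≤′t)
      t≤n = ℕP.<⇒≤ 1+t≤n

  ΣU-nonNeg : ∀ {a b} → 1 ℕ.≤ a → a ℕ.≤ b → b ℕ.≤ suc m → 0ℚ ℚ.≤ sumFrom U a (b ℕ.∸ a)
  ΣU-nonNeg {a} {b} 1≤a a≤b b≤n = sumFrom-nonNeg U a (b ℕ.∸ a) λ t a≤t t<a+[b∸a] →
    let t<b = subst (t ℕ.<_) (ℕP.m+[n∸m]≡n a≤b) t<a+[b∸a] in
    divℕ-nonNeg (C t) (T t) (C-nonNeg t (ℕP.≤-trans 1≤a a≤t) (ℕP.<-≤-trans t<b b≤n))

  ΣC≤*ΣU : ∀ B {a b} → 1 ℕ.≤ a → a ℕ.≤ b → b ℕ.≤ suc m → (∀ t → a ℕ.≤ t → t ℕ.< b → T t ℕ.≤ B) →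
    sumFrom C a (b ℕ.∸ a) ℚ.≤ ℕ→ℚ B ℚ.* sumFrom U a (b ℕ.∸ a)
  ΣC≤*ΣU B {a} {b} 1≤a a≤b b≤n T≤B = sumFrom-≤-* C U (ℕ→ℚ B) a (b ℕ.∸ a) λ t a≤t t<a+[b∸a] →
    let t<b = subst (t ℕ.<_) (ℕP.m+[n∸m]≡n a≤b) t<a+[b∸a]
        1≤t = ℕP.≤-trans 1≤a a≤t
        t<n = ℕP.<-≤-trans t<b b≤n in
    ≤-*-divℕ (C t) (T-pos t 1≤t (ℕP.<⇒≤ t<n)) (T≤B t a≤t t<b) (C-nonNeg t 1≤t t<n)

  ΣU-suffix-≤ : ∀ {b} → 1 ℕ.≤ b → b ℕ.≤ suc m → sumFrom U b (suc m ℕ.∸ b) ℚ.≤ sumFrom U 1 m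
  ΣU-suffix-≤ {b} 1≤b b≤n = begin
    suffix              ≡⟨ sym (ℚP.+-identityˡ suffix) ⟩
    0ℚ ℚ.+ suffix       ≤⟨ ℚP.+-monoˡ-≤ suffix (ΣU-nonNeg ℕP.≤-refl 1≤b b≤n) ⟩
    sumFrom U 1 (b ℕ.∸ 1) ℚ.+ suffix ≡⟨ sym (sumFrom-split U 1≤b b≤n) ⟩
    sumFrom U 1 m       ∎
    where
    open ℚP.≤-Reasoning
    suffix = sumFrom U b (suc m ℕ.∸ b)

  solution-row : ∀ J {x j} → IsSolution (suc m) T C J x → 1 ℕ.≤ j → j ℕ.≤ suc m →
    pt T J x j ℚ.≤ pt T J x (suc m) × pt T J x (suc m) ℚ.≤ pt T J x j ℚ.+ c j
  solution-row J {x} sol 1≤j j≤n with ℕP.m≤n⇒m<n∨m≡n j≤n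
  ... | inj₁ j<n  = sol _ 1≤j j<n
  ... | inj₂ refl = ℚP.≤-refl , ℚP.≤-reflexive (sym (begin
    pt T J x (suc m) ℚ.+ c (suc m) ≡⟨ cong (pt T J x (suc m) ℚ.+_) (m≤j⇒cⱼ≡0 (ℕP.n≤1+n m)) ⟩
    pt T J x (suc m) ℚ.+ 0ℚ        ≡⟨ ℚP.+-identityʳ _ ⟩
    pt T J x (suc m)               ∎))
    where open ≡-Reasoning

  module _ {i k} (1≤i : 1 ℕ.≤ i) (i≤m : i ℕ.≤ m) (k-max : IsMaxEqPeriod (suc m) T i k) where

    private
      1≤k = proj₁ k-max
      k≤n = proj₁ (proj₂ k-max)
      Tₖ≡T[1+i] = proj₁ (proj₂ (proj₂ k-max))
      maximal = proj₂ (proj₂ (proj₂ k-max))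
      Tₖ = ℕ→ℚ (T k)

    1+i≤k : suc i ℕ.≤ k
    1+i≤k = maximal (suc i) (s≤s z≤n) (s≤s i≤m) refl

    T≤Tₖ : ∀ t → suc i ℕ.≤ t → t ℕ.< suc m → T t ℕ.≤ T k
    T≤Tₖ t 1+i≤t t<n = subst (T t ℕ.≤_) (sym Tₖ≡T[1+i]) (T-antitone (s≤s z≤n) 1+i≤t (ℕP.<⇒≤ t<n))

    2T[1+k]≤Tₖ : k ℕ.≤ m → T (suc k) ℕ.+ T (suc k) ℕ.≤ T k
    2T[1+k]≤Tₖ k≤m = m∣n∧m≢n⇒m+m≤n (T-pos k 1≤k k≤n) (T-harmonic k 1≤k (s≤s k≤m))
      λ T[1+k]≡Tₖ → ℕP.n≮n k (maximal (suc k) (s≤s z≤n) (s≤s k≤m) (trans T[1+k]≡Tₖ Tₖ≡T[1+i]))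

    -- The tasks after k are counted twice (in c_i and c_k), which 2 T_t ≤ T_k pays for.
    cᵢ+cₖ≤Tₖ*ΣU : c i ℚ.+ c k ℚ.≤ Tₖ ℚ.* sumFrom U (suc i) (m ℕ.∸ i)
    cᵢ+cₖ≤Tₖ*ΣU with k ℕ.≤? m
    ... | no k≰m = begin
      c i ℚ.+ c k   ≡⟨ cong (c i ℚ.+_) (m≤j⇒cⱼ≡0 (ℕP.<⇒≤ (ℕP.≰⇒> k≰m))) ⟩
      c i ℚ.+ 0ℚ    ≡⟨ ℚP.+-identityʳ (c i) ⟩
      c i           ≤⟨ ΣC≤*ΣU (T k) (s≤s z≤n) (s≤s i≤m) ℕP.≤-refl T≤Tₖ ⟩
      Tₖ ℚ.* sumFrom U (suc i) (m ℕ.∸ i) ∎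
      where open ℚP.≤-Reasoning
    ... | yes k≤m = begin
      c i ℚ.+ c k                  ≡⟨ cong (ℚ._+ c k) (sumFrom-split C 1+i≤1+k (s≤s k≤m)) ⟩
      (A ℚ.+ c k) ℚ.+ c k          ≡⟨ ℚP.+-assoc A (c k) (c k) ⟩
      A ℚ.+ (c k ℚ.+ c k)          ≤⟨ ℚP.+-mono-≤ A≤Tₖ*Uᴬ 2cₖ≤Tₖ*Uᴮ ⟩
      Tₖ ℚ.* Uᴬ ℚ.+ Tₖ ℚ.* Uᴮ      ≡⟨ sym (ℚP.*-distribˡ-+ Tₖ Uᴬ Uᴮ) ⟩
      Tₖ ℚ.* (Uᴬ ℚ.+ Uᴮ)           ≡⟨ cong (Tₖ ℚ.*_) (sym (sumFrom-split U 1+i≤1+k (s≤s k≤m))) ⟩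
      Tₖ ℚ.* sumFrom U (suc i) (m ℕ.∸ i) ∎
      where
      open ℚP.≤-Reasoning
      1+i≤1+k = ℕP.m≤n⇒m≤1+n 1+i≤k
      A  = sumFrom C (suc i) (k ℕ.∸ i)
      Uᴬ = sumFrom U (suc i) (k ℕ.∸ i)
      Uᴮ = sumFrom U (suc k) (m ℕ.∸ k)
      A≤Tₖ*Uᴬ : A ℚ.≤ Tₖ ℚ.* Uᴬ
      A≤Tₖ*Uᴬ = ΣC≤*ΣU (T k) (s≤s z≤n) 1+i≤1+k (s≤s k≤m)
        λ t 1+i≤t t≤k → T≤Tₖ t 1+i≤t (ℕP.<-≤-trans t≤k (s≤s k≤m))
      2cₖ≤Tₖ*Uᴮ : c k ℚ.+ c k ℚ.≤ Tₖ ℚ.* Uᴮ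
      2cₖ≤Tₖ*Uᴮ = double-≤-* {b = T (suc k)} (ΣU-nonNeg (s≤s z≤n) (s≤s k≤m) ℕP.≤-refl)
        (ΣC≤*ΣU (T (suc k)) (s≤s z≤n) (s≤s k≤m) ℕP.≤-refl
          λ t 1+k≤t t<n → T-antitone (s≤s z≤n) 1+k≤t (ℕP.<⇒≤ t<n))
        (2T[1+k]≤Tₖ k≤m)

    cᵢ+cₖ<Tₖ : sumFrom U 1 m ℚ.< 1ℚ → c i ℚ.+ c k ℚ.< Tₖ
    cᵢ+cₖ<Tₖ ΣU<1 = begin-strict
      c i ℚ.+ c k                        ≤⟨ cᵢ+cₖ≤Tₖ*ΣU ⟩
      Tₖ ℚ.* sumFrom U (suc i) (m ℕ.∸ i) ≤⟨ ℚP.*-monoˡ-≤-nonNeg Tₖ {{ℚ.nonNegative 0≤Tₖ}}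
                                              (ΣU-suffix-≤ (s≤s z≤n) (s≤s i≤m)) ⟩
      Tₖ ℚ.* sumFrom U 1 m               <⟨ ℚP.*-monoʳ-<-pos Tₖ {{ℚ.positive 0<Tₖ}} ΣU<1 ⟩
      Tₖ ℚ.* 1ℚ                          ≡⟨ ℚP.*-identityʳ Tₖ ⟩
      Tₖ                                 ∎
      where
      open ℚP.≤-Reasoning
      0<Tₖ : 0ℚ ℚ.< Tₖ
      0<Tₖ = ℕ→ℚ-mono-< (T-pos k 1≤k k≤n)
      0≤Tₖ = ℚP.<⇒≤ 0<Tₖ

    xᵢ≡x′ᵢ⇒xₖ≤x′ₖ : ∀ J {x x′} → sumFrom U 1 m ℚ.< 1ℚ →
      IsSolution (suc m) T C J x → IsSolution (suc m) T C J x′ → x i ≡ x′ i → x k ℤ.≤ x′ k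
    xᵢ≡x′ᵢ⇒xₖ≤x′ₖ J {x} {x′} ΣU<1 sol sol′ xᵢ≡x′ᵢ = offset-multiple-<⇒≤ (J k) (T k) (x k) (x′ k) (begin-strict
      pt T J x k                          ≤⟨ proj₁ (solution-row J sol 1≤k k≤n) ⟩
      pt T J x (suc m)                    ≤⟨ proj₂ (sol i 1≤i (s≤s i≤m)) ⟩
      pt T J x i ℚ.+ c i                  ≡⟨ cong (λ v → J i ℚ.+ ℤ→ℚ (+ T i ℤ.* v) ℚ.+ c i) xᵢ≡x′ᵢ ⟩
      pt T J x′ i ℚ.+ c i                 ≤⟨ ℚP.+-monoˡ-≤ (c i) (proj₁ (sol′ i 1≤i (s≤s i≤m))) ⟩
      pt T J x′ (suc m) ℚ.+ c i           ≤⟨ ℚP.+-monoˡ-≤ (c i) (proj₂ (solution-row J sol′ 1≤k k≤n)) ⟩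
      pt T J x′ k ℚ.+ c k ℚ.+ c i         ≡⟨ ℚP.+-assoc (pt T J x′ k) (c k) (c i) ⟩
      pt T J x′ k ℚ.+ (c k ℚ.+ c i)       ≡⟨ cong (pt T J x′ k ℚ.+_) (ℚP.+-comm (c k) (c i)) ⟩
      pt T J x′ k ℚ.+ (c i ℚ.+ c k)       <⟨ ℚP.+-monoʳ-< (pt T J x′ k) (cᵢ+cₖ<Tₖ ΣU<1) ⟩
      pt T J x′ k ℚ.+ Tₖ                  ∎)
      where open ℚP.≤-Reasoning

lemma15 : (n : ℕ) → 2 ℕ.≤ n →
    (T : ℕ → ℕ) (C J : ℕ → ℚ) →
    (∀ t → 1 ℕ.≤ t → t ℕ.≤ n → 0 ℕ.< T t) →
    (∀ t → 1 ℕ.≤ t → t ℕ.< n → T (suc t) ∣ T t) →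
    (∀ t → 1 ℕ.≤ t → t ℕ.< n → 0ℚ ℚ.≤ C t) →
    sumRange (λ t → divℕ (C t) (T t)) 1 (n ℕ.∸ 1) ℚ.< 1ℚ →
    (i k : ℕ) → 1 ℕ.≤ i → i ℕ.< n → IsMaxEqPeriod n T i k →
    (z y y′ : ℤ) (x x′ : ℕ → ℤ) →
    IsSolution n T C J x → x i ≡ z → x k ≡ y →
    IsSolution n T C J x′ → x′ i ≡ z → x′ k ≡ y′ →
    y ≡ y′
lemma15 zero ()
lemma15 (suc m) _ T C J T-pos T-harmonic C-nonNeg ΣU<1 i k 1≤i (s≤s i≤m) k-max z y y′ x x′
        sol xᵢ≡z xₖ≡y sol′ x′ᵢ≡z x′ₖ≡y′ = begin
  y    ≡⟨ sym xₖ≡y ⟩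
  x k  ≡⟨ ℤP.≤-antisym (xₖ≤x′ₖ sol sol′ (trans xᵢ≡z (sym x′ᵢ≡z))) (xₖ≤x′ₖ sol′ sol (trans x′ᵢ≡z (sym xᵢ≡z))) ⟩
  x′ k ≡⟨ x′ₖ≡y′ ⟩
  y′   ∎
  where
  open ≡-Reasoning
  open HarmonicTasks m T C T-pos T-harmonic C-nonNeg using (xᵢ≡x′ᵢ⇒xₖ≤x′ₖ)
  xₖ≤x′ₖ : ∀ {u u′} → IsSolution (suc m) T C J u → IsSolution (suc m) T C J u′ → u i ≡ u′ i → u k ℤ.≤ u′ k
  xₖ≤x′ₖ = xᵢ≡x′ᵢ⇒xₖ≤x′ₖ 1≤i i≤m k-max J ΣU<1
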